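{- For each finite type $\sigma$: (1) $\mathsf{HA}^\omega\vdash\forall x:\sigma^+\,\neg\exists z:\sigma^-.\,\mathrm{app}_\sigma(x,x,z)$. (2) There is a closed term $s:\sigma^+\to\sigma^+\to\sigma^-\to\sigma^-$ such that $\mathsf{HA}^\omega\vdash\forall x,y:\sigma^+\forall z:\sigma^-(\mathrm{app}_\sigma(x,y,z)\to\mathrm{app}_\sigma(y,x,sxyz))$. (3) There is a closed term $t:\sigma^+\to\sigma^+\to\sigma^+\to\sigma^-\to\sigma^-\times0$ such that $\mathsf{HA}^\omega$ proves: for all $x,y,z:\sigma^+$ and $u:\sigma^-$, if $\mathrm{app}_\sigma(x,y,u)$ then, writing $p:=txyzu$, we have $\mathrm{app}_\sigma(x,z,\mathsf{fst}\,p)$ whenever $\mathsf{snd}\,p\equiv_00$, and $\mathrm{app}_\sigma(y,z,\mathsf{fst}\,p)$ whenever $\neg(\mathsf{snd}\,p\equiv_00)$.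
   Context: Finite types are generated by: $0$ is a type; if $\sigma,\tau$ are types, so are $\sigma\times\tau$ and $\sigma\to\tau$ ($\to$ associates to the right). $\mathsf{HA}^\omega$ is the many-sorted intuitionistic first-order theory whose sorts are the finite types. Its terms are built from variables and, for all types $\rho,\sigma,\tau$, the constants $\mathsf{k}:\rho\to\sigma\to\rho$, $\mathsf{s}:(\rho\to\sigma\to\tau)\to(\rho\to\sigma)\to(\rho\to\tau)$, $\mathsf{pair}:\sigma\to\tau\to\sigma\times\tau$, $\mathsf{fst}:\sigma\times\tau\to\sigma$, $\mathsf{snd}:\sigma\times\tau\to\tau$, $0:0$, $S:0\to0$, $\mathsf{R}:\sigma\to(0\to\sigma\to\sigma)\to0\to\sigma$, by application (associating to the left). Atomic formulas are $\bot$ and $s\equiv_\sigma t$; $\neg\varphi$ abbreviates $\varphi\to\bot$. Axioms: $\equiv_\sigma$ is an equivalence relation; $x\equiv x'\to y\equiv y'\to xy\equiv x'y'$; $\mathsf{k}xy\equiv x$; $\mathsf{s}xyz\equiv xz(yz)$; $\mathsf{fst}(\mathsf{pair}\,xy)\equiv x$; $\mathsf{snd}(\mathsf{pair}\,xy)\equiv y$; $\mathsf{R}xy0\equiv x$; $\mathsf{R}xy(Sm)\equiv ym(\mathsf{R}xym)$; $Sx\equiv_0Sy\to x\equiv_0y$; $\neg(Sx\equiv_00)$; induction for all formulas. Auxiliary types and formulas (by induction on $\sigma$): $0^+:=0$, $0^-:=0$, $\mathrm{dom}_0(x):=\top$, $\mathrm{app}_0(x,y,z):=\neg(x\equiv_0y)$.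 $(\sigma\times\tau)^+:=\sigma^+\times\tau^+$, $(\sigma\times\tau)^-:=(\sigma^-\times\tau^-)\times0$, $\mathrm{dom}_{\sigma\times\tau}(x):=\mathrm{dom}_\sigma(\mathsf{fst}\,x)\wedge\mathrm{dom}_\tau(\mathsf{snd}\,x)$, $\mathrm{app}_{\sigma\times\tau}(x,y,z):=(\mathsf{snd}\,z\equiv_00\to\mathrm{app}_\sigma(\mathsf{fst}\,x,\mathsf{fst}\,y,\mathsf{fst}(\mathsf{fst}\,z)))\wedge(\neg(\mathsf{snd}\,z\equiv_00)\to\mathrm{app}_\tau(\mathsf{snd}\,x,\mathsf{snd}\,y,\mathsf{snd}(\mathsf{fst}\,z)))$. $(\sigma\to\tau)^+:=(\sigma^+\to\tau^+)\times(\sigma^+\to\sigma^+\to\tau^-\to\sigma^-)$, $(\sigma\to\tau)^-:=\sigma^+\times\tau^-$; for $s:(\sigma\to\tau)^+$, $t:\sigma^+$ write $s*t:=(\mathsf{fst}\,s)t$; $\mathrm{dom}_{\sigma\to\tau}(x):=\forall u:\sigma^+(\mathrm{dom}_\sigma(u)\to\mathrm{dom}_\tau(x*u))\wedge\forall u,v:\sigma^+\forall w:\tau^-(\mathrm{dom}_\sigma(u)\to\mathrm{dom}_\sigma(v)\to\mathrm{app}_\tau(x*u,x*v,w)\to\mathrm{app}_\sigma(u,v,(\mathsf{snd}\,x)uvw))$; $\mathrm{app}_{\sigma\to\tau}(x,y,z):=\mathrm{dom}_\sigma(\mathsf{fst}\,z)\wedge\mathrm{app}_\tau(x*(\mathsf{fst}\,z),y*(\mathsf{fst}\,z),\mathsf{snd}\,z)$.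 -}

module Defs where

open import Data.List using (List; []; _∷_; map)
open import Data.List.Membership.Propositional using (_∈_)

infixr 7 _⊗_
infixr 5 _⇒_

data Ty : Set where
  𝟘   : Ty
  _⊗_ : Ty → Ty → Ty
  _⇒_ : Ty → Ty → Ty

Ctx : Set
Ctx = List Ty

infix 4 _∋_
data _∋_ : Ctx → Ty → Set where
  here  : ∀ {Γ σ} → (σ ∷ Γ) ∋ σ
  there : ∀ {Γ σ τ} → Γ ∋ σ → (τ ∷ Γ) ∋ σ

infixl 9 _·_

data Tm (Γ : Ctx) : Ty → Set where
  var  : ∀ {σ} → Γ ∋ σ → Tm Γ σ
  Kc   : ∀ {ρ σ} → Tm Γ (ρ ⇒ σ ⇒ ρ)
  Sc   : ∀ {ρ σ τ} → Tm Γ ((ρ ⇒ σ ⇒ τ) ⇒ (ρ ⇒ σ) ⇒ (ρ ⇒ τ))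
  Pair : ∀ {σ τ} → Tm Γ (σ ⇒ τ ⇒ σ ⊗ τ)
  Fst  : ∀ {σ τ} → Tm Γ (σ ⊗ τ ⇒ σ)
  Snd  : ∀ {σ τ} → Tm Γ (σ ⊗ τ ⇒ τ)
  Zero : Tm Γ 𝟘
  Succ : Tm Γ (𝟘 ⇒ 𝟘)
  Rec  : ∀ {σ} → Tm Γ (σ ⇒ (𝟘 ⇒ σ ⇒ σ) ⇒ 𝟘 ⇒ σ)
  _·_  : ∀ {σ τ} → Tm Γ (σ ⇒ τ) → Tm Γ σ → Tm Γ τ

infix  6 _≐_
infixr 4 _∧ᶠ_
infixr 3 _∨ᶠ_
infixr 2 _⊃_

data Fm (Γ : Ctx) : Set where
  ⊥ᶠ   : Fm Γ
  _≐_  : ∀ {σ} → Tm Γ σ → Tm Γ σ → Fm Γ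
  _∧ᶠ_ : Fm Γ → Fm Γ → Fm Γ
  _∨ᶠ_ : Fm Γ → Fm Γ → Fm Γ
  _⊃_  : Fm Γ → Fm Γ → Fm Γ
  ∀ᶠ   : (σ : Ty) → Fm (σ ∷ Γ) → Fm Γ
  ∃ᶠ   : (σ : Ty) → Fm (σ ∷ Γ) → Fm Γ

¬ᶠ_ : ∀ {Γ} → Fm Γ → Fm Γ
¬ᶠ φ = φ ⊃ ⊥ᶠ

⊤ᶠ : ∀ {Γ} → Fm Γ
⊤ᶠ = ⊥ᶠ ⊃ ⊥ᶠ

Ren : Ctx → Ctx → Set
Ren Γ Δ = ∀ {σ} → Γ ∋ σ → Δ ∋ σ

liftR : ∀ {Γ Δ τ} → Ren Γ Δ → Ren (τ ∷ Γ) (τ ∷ Δ)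
liftR ρ here      = here
liftR ρ (there x) = there (ρ x)

ren : ∀ {Γ Δ σ} → Ren Γ Δ → Tm Γ σ → Tm Δ σ
ren ρ (var x) = var (ρ x)
ren ρ Kc      = Kc
ren ρ Sc      = Sc
ren ρ Pair    = Pair
ren ρ Fst     = Fst
ren ρ Snd     = Snd
ren ρ Zero    = Zero
ren ρ Succ    = Succ
ren ρ Rec     = Rec
ren ρ (t · u) = ren ρ t · ren ρ u

renF : ∀ {Γ Δ} → Ren Γ Δ → Fm Γ → Fm Δ
renF ρ ⊥ᶠ       = ⊥ᶠ
renF ρ (t ≐ u)  = ren ρ t ≐ ren ρ u
renF ρ (φ ∧ᶠ ψ) = renF ρ φ ∧ᶠ renF ρ ψ
renF ρ (φ ∨ᶠ ψ) = renF ρ φ ∨ᶠ renF ρ ψ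
renF ρ (φ ⊃ ψ)  = renF ρ φ ⊃ renF ρ ψ
renF ρ (∀ᶠ σ φ) = ∀ᶠ σ (renF (liftR ρ) φ)
renF ρ (∃ᶠ σ φ) = ∃ᶠ σ (renF (liftR ρ) φ)

wk : ∀ {Γ σ τ} → Tm Γ σ → Tm (τ ∷ Γ) σ
wk = ren there

wkF : ∀ {Γ τ} → Fm Γ → Fm (τ ∷ Γ)
wkF = renF there

cl : ∀ {Γ σ} → Tm [] σ → Tm Γ σ
cl = ren (λ ())

Sub : Ctx → Ctx → Set
Sub Γ Δ = ∀ {σ} → Γ ∋ σ → Tm Δ σ

liftS : ∀ {Γ Δ τ} → Sub Γ Δ → Sub (τ ∷ Γ) (τ ∷ Δ)
liftS θ here      = var here
liftS θ (there x) = wk (θ x)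

sub : ∀ {Γ Δ σ} → Sub Γ Δ → Tm Γ σ → Tm Δ σ
sub θ (var x) = θ x
sub θ Kc      = Kc
sub θ Sc      = Sc
sub θ Pair    = Pair
sub θ Fst     = Fst
sub θ Snd     = Snd
sub θ Zero    = Zero
sub θ Succ    = Succ
sub θ Rec     = Rec
sub θ (t · u) = sub θ t · sub θ u

subF : ∀ {Γ Δ} → Sub Γ Δ → Fm Γ → Fm Δ
subF θ ⊥ᶠ       = ⊥ᶠ
subF θ (t ≐ u)  = sub θ t ≐ sub θ u
subF θ (φ ∧ᶠ ψ) = subF θ φ ∧ᶠ subF θ ψ
subF θ (φ ∨ᶠ ψ) = subF θ φ ∨ᶠ subF θ ψ
subF θ (φ ⊃ ψ)  = subF θ φ ⊃ subF θ ψ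
subF θ (∀ᶠ σ φ) = ∀ᶠ σ (subF (liftS θ) φ)
subF θ (∃ᶠ σ φ) = ∃ᶠ σ (subF (liftS θ) φ)

sub0 : ∀ {Γ σ} → Tm Γ σ → Sub (σ ∷ Γ) Γ
sub0 t here      = t
sub0 t (there x) = var x

_[_] : ∀ {Γ σ} → Fm (σ ∷ Γ) → Tm Γ σ → Fm Γ
φ [ t ] = subF (sub0 t) φ

subSucc : ∀ {Γ} → Sub (𝟘 ∷ Γ) (𝟘 ∷ Γ)
subSucc here      = Succ · var here
subSucc (there x) = var (there x)

-- Derivations of HA^ω: intuitionistic natural deduction (sequents with
-- a context Γ of typed variables and a list Δ of hypotheses), plus the
-- nonlogical axioms of HA^ω (as schemata over arbitrary terms, which is
-- equivalent to their universal closures) and induction for all formulas.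

data Pf : (Γ : Ctx) → List (Fm Γ) → Fm Γ → Set where
  hyp   : ∀ {Γ Δ φ} → φ ∈ Δ → Pf Γ Δ φ
  ⊥E    : ∀ {Γ Δ φ} → Pf Γ Δ ⊥ᶠ → Pf Γ Δ φ
  ∧I    : ∀ {Γ Δ φ ψ} → Pf Γ Δ φ → Pf Γ Δ ψ → Pf Γ Δ (φ ∧ᶠ ψ)
  ∧E₁   : ∀ {Γ Δ φ ψ} → Pf Γ Δ (φ ∧ᶠ ψ) → Pf Γ Δ φ
  ∧E₂   : ∀ {Γ Δ φ ψ} → Pf Γ Δ (φ ∧ᶠ ψ) → Pf Γ Δ ψ
  ∨I₁   : ∀ {Γ Δ φ ψ} → Pf Γ Δ φ → Pf Γ Δ (φ ∨ᶠ ψ)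
  ∨I₂   : ∀ {Γ Δ φ ψ} → Pf Γ Δ ψ → Pf Γ Δ (φ ∨ᶠ ψ)
  ∨E    : ∀ {Γ Δ φ ψ χ} → Pf Γ Δ (φ ∨ᶠ ψ) → Pf Γ (φ ∷ Δ) χ → Pf Γ (ψ ∷ Δ) χ
          → Pf Γ Δ χ
  ⊃I    : ∀ {Γ Δ φ ψ} → Pf Γ (φ ∷ Δ) ψ → Pf Γ Δ (φ ⊃ ψ)
  ⊃E    : ∀ {Γ Δ φ ψ} → Pf Γ Δ (φ ⊃ ψ) → Pf Γ Δ φ → Pf Γ Δ ψ
  ∀I    : ∀ {Γ Δ σ φ} → Pf (σ ∷ Γ) (map wkF Δ) φ → Pf Γ Δ (∀ᶠ σ φ)
  ∀E    : ∀ {Γ Δ σ φ} → Pf Γ Δ (∀ᶠ σ φ) → (t : Tm Γ σ) → Pf Γ Δ (φ [ t ])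
  ∃I    : ∀ {Γ Δ σ φ} → (t : Tm Γ σ) → Pf Γ Δ (φ [ t ]) → Pf Γ Δ (∃ᶠ σ φ)
  ∃E    : ∀ {Γ Δ σ φ ψ} → Pf Γ Δ (∃ᶠ σ φ)
          → Pf (σ ∷ Γ) (φ ∷ map wkF Δ) (wkF ψ) → Pf Γ Δ ψ
  eq-refl  : ∀ {Γ Δ σ} (x : Tm Γ σ) → Pf Γ Δ (x ≐ x)
  eq-sym   : ∀ {Γ Δ σ} (x y : Tm Γ σ) → Pf Γ Δ (x ≐ y ⊃ y ≐ x)
  eq-trans : ∀ {Γ Δ σ} (x y z : Tm Γ σ) → Pf Γ Δ (x ≐ y ⊃ y ≐ z ⊃ x ≐ z)
  eq-cong  : ∀ {Γ Δ σ τ} (x x' : Tm Γ (σ ⇒ τ)) (y y' : Tm Γ σ)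
             → Pf Γ Δ (x ≐ x' ⊃ y ≐ y' ⊃ x · y ≐ x' · y')
  ax-k    : ∀ {Γ Δ ρ σ} (x : Tm Γ ρ) (y : Tm Γ σ) → Pf Γ Δ (Kc · x · y ≐ x)
  ax-s    : ∀ {Γ Δ ρ σ τ} (x : Tm Γ (ρ ⇒ σ ⇒ τ)) (y : Tm Γ (ρ ⇒ σ)) (z : Tm Γ ρ)
            → Pf Γ Δ (Sc · x · y · z ≐ x · z · (y · z))
  ax-fst  : ∀ {Γ Δ σ τ} (x : Tm Γ σ) (y : Tm Γ τ) → Pf Γ Δ (Fst · (Pair · x · y) ≐ x)
  ax-snd  : ∀ {Γ Δ σ τ} (x : Tm Γ σ) (y : Tm Γ τ) → Pf Γ Δ (Snd · (Pair · x · y) ≐ y)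
  ax-R0   : ∀ {Γ Δ σ} (x : Tm Γ σ) (y : Tm Γ (𝟘 ⇒ σ ⇒ σ)) → Pf Γ Δ (Rec · x · y · Zero ≐ x)
  ax-RS   : ∀ {Γ Δ σ} (x : Tm Γ σ) (y : Tm Γ (𝟘 ⇒ σ ⇒ σ)) (m : Tm Γ 𝟘)
            → Pf Γ Δ (Rec · x · y · (Succ · m) ≐ y · m · (Rec · x · y · m))
  ax-Sinj : ∀ {Γ Δ} (x y : Tm Γ 𝟘) → Pf Γ Δ (Succ · x ≐ Succ · y ⊃ x ≐ y)
  ax-S≠0  : ∀ {Γ Δ} (x : Tm Γ 𝟘) → Pf Γ Δ (¬ᶠ (Succ · x ≐ Zero))
  ax-ind  : ∀ {Γ Δ} (φ : Fm (𝟘 ∷ Γ))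
            → Pf Γ Δ ((φ [ Zero ] ∧ᶠ ∀ᶠ 𝟘 (φ ⊃ subF subSucc φ)) ⊃ ∀ᶠ 𝟘 φ)

HA⊢_ : Fm [] → Set
HA⊢ φ = Pf [] [] φ

_⁺ _⁻ : Ty → Ty
𝟘 ⁺       = 𝟘
(σ ⊗ τ) ⁺ = σ ⁺ ⊗ τ ⁺
(σ ⇒ τ) ⁺ = (σ ⁺ ⇒ τ ⁺) ⊗ (σ ⁺ ⇒ σ ⁺ ⇒ τ ⁻ ⇒ σ ⁻)
𝟘 ⁻       = 𝟘
(σ ⊗ τ) ⁻ = (σ ⁻ ⊗ τ ⁻) ⊗ 𝟘
(σ ⇒ τ) ⁻ = σ ⁺ ⊗ τ ⁻

_*_ : ∀ {Γ σ τ} → Tm Γ ((σ ⇒ τ) ⁺) → Tm Γ (σ ⁺) → Tm Γ (τ ⁺)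
s * t = Fst · s · t

#0 : ∀ {Γ σ} → Tm (σ ∷ Γ) σ
#0 = var here
#1 : ∀ {Γ σ τ₀} → Tm (τ₀ ∷ σ ∷ Γ) σ
#1 = var (there here)
#2 : ∀ {Γ σ τ₀ τ₁} → Tm (τ₀ ∷ τ₁ ∷ σ ∷ Γ) σ
#2 = var (there (there here))
#3 : ∀ {Γ σ τ₀ τ₁ τ₂} → Tm (τ₀ ∷ τ₁ ∷ τ₂ ∷ σ ∷ Γ) σ
#3 = var (there (there (there here)))

dom : (σ : Ty) → ∀ {Γ} → Tm Γ (σ ⁺) → Fm Γ
app : (σ : Ty) → ∀ {Γ} → Tm Γ (σ ⁺) → Tm Γ (σ ⁺) → Tm Γ (σ ⁻) → Fm Γ

dom 𝟘 x       = ⊤ᶠ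
dom (σ ⊗ τ) x = dom σ (Fst · x) ∧ᶠ dom τ (Snd · x)
dom (σ ⇒ τ) x =
  ∀ᶠ (σ ⁺) (dom σ #0 ⊃ dom τ (wk x * #0))
  ∧ᶠ ∀ᶠ (σ ⁺) (∀ᶠ (σ ⁺) (∀ᶠ (τ ⁻)
       (dom σ #2 ⊃ dom σ #1 ⊃
        app τ (x₃ * #2) (x₃ * #1) #0 ⊃
        app σ #2 #1 (Snd · x₃ · #2 · #1 · #0))))
  where
  x₃ = wk (wk (wk x))

app 𝟘 x y z       = ¬ᶠ (x ≐ y)
app (σ ⊗ τ) x y z =
  ((Snd · z ≐ Zero) ⊃ app σ (Fst · x) (Fst · y) (Fst · (Fst · z)))
  ∧ᶠ ((¬ᶠ (Snd · z ≐ Zero)) ⊃ app τ (Snd · x) (Snd · y) (Snd · (Fst · z)))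
app (σ ⇒ τ) x y z = dom σ (Fst · z) ∧ᶠ app τ (x * (Fst · z)) (y * (Fst · z)) (Snd · z)

-- At type 0, app is inequality, and cotransitivity uses a term eqb deciding equality: if x = z,
-- then x ≠ y gives y ≠ z. At σ × τ the flag snd u records which component is apart, and the
-- witnesses recurse into that component by a definition by cases on the flag. At σ → τ, app is
-- app_τ at a common argument fst u in dom_σ, and the witnesses recurse on τ keeping that argument.
-- The witnesses are written as λ-terms and compiled into k and s by bracket abstraction.

module Submission where

open import Defs
open import Data.Product using (Σ; _×_; _,_)
open import Data.List using (List; []; _∷_; map)
open import Data.List.Membership.Propositional using (_∈_)
open import Data.List.Membership.Propositional.Properties using (∈-map⁺; ∈-map⁻)
import Data.List.Relation.Unary.Any as Any
open import Relation.Binary.PropositionalEquality using (_≡_; refl; sym; trans; cong; cong₂; subst)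



infix 4 _≗ᵣ_ _≗ₛ_

_≗ᵣ_ : ∀ {Γ Δ} → Ren Γ Δ → Ren Γ Δ → Set
_≗ᵣ_ {Γ} ρ ρ′ = ∀ {τ} (v : Γ ∋ τ) → ρ v ≡ ρ′ v

_≗ₛ_ : ∀ {Γ Δ} → Sub Γ Δ → Sub Γ Δ → Set
_≗ₛ_ {Γ} θ θ′ = ∀ {τ} (v : Γ ∋ τ) → θ v ≡ θ′ v

liftR-ext : ∀ {Γ Δ τ} {ρ ρ′ : Ren Γ Δ} → ρ ≗ᵣ ρ′ → liftR {τ = τ} ρ ≗ᵣ liftR ρ′
liftR-ext e here      = refl
liftR-ext e (there v) = cong there (e v)

liftS-ext : ∀ {Γ Δ τ} {θ θ′ : Sub Γ Δ} → θ ≗ₛ θ′ → liftS {τ = τ} θ ≗ₛ liftS θ′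
liftS-ext e here      = refl
liftS-ext e (there v) = cong wk (e v)

liftR-id : ∀ {Γ τ} → liftR {τ = τ} (λ (v : Γ ∋ _) → v) ≗ᵣ (λ v → v)
liftR-id here      = refl
liftR-id (there v) = refl

liftR-∘ : ∀ {Γ Δ Θ τ} (ρ : Ren Δ Θ) (ρ′ : Ren Γ Δ)
        → (λ v → liftR {τ = τ} ρ (liftR ρ′ v)) ≗ᵣ liftR (λ v → ρ (ρ′ v))
liftR-∘ ρ ρ′ here      = refl
liftR-∘ ρ ρ′ (there v) = refl

liftS-liftR : ∀ {Γ Δ Θ τ} (θ : Sub Δ Θ) (ρ : Ren Γ Δ)
            → (λ v → liftS {τ = τ} θ (liftR ρ v)) ≗ₛ liftS (λ v → θ (ρ v))
liftS-liftR θ ρ here      = refl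
liftS-liftR θ ρ (there v) = refl

liftS-var : ∀ {Γ τ} → liftS {τ = τ} (λ (v : Γ ∋ _) → var v) ≗ₛ var
liftS-var here      = refl
liftS-var (there v) = refl

ren-ext : ∀ {Γ Δ σ} {ρ ρ′ : Ren Γ Δ} → ρ ≗ᵣ ρ′ → (t : Tm Γ σ) → ren ρ t ≡ ren ρ′ t
ren-ext e (var x) = cong var (e x)
ren-ext e Kc      = refl
ren-ext e Sc      = refl
ren-ext e Pair    = refl
ren-ext e Fst     = refl
ren-ext e Snd     = refl
ren-ext e Zero    = refl
ren-ext e Succ    = refl
ren-ext e Rec     = refl
ren-ext e (t · u) = cong₂ _·_ (ren-ext e t) (ren-ext e u)

sub-ext : ∀ {Γ Δ σ} {θ θ′ : Sub Γ Δ} → θ ≗ₛ θ′ → (t : Tm Γ σ) → sub θ t ≡ sub θ′ t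
sub-ext e (var x) = e x
sub-ext e Kc      = refl
sub-ext e Sc      = refl
sub-ext e Pair    = refl
sub-ext e Fst     = refl
sub-ext e Snd     = refl
sub-ext e Zero    = refl
sub-ext e Succ    = refl
sub-ext e Rec     = refl
sub-ext e (t · u) = cong₂ _·_ (sub-ext e t) (sub-ext e u)

ren-ren : ∀ {Γ Δ Θ σ} (ρ : Ren Δ Θ) (ρ′ : Ren Γ Δ) (t : Tm Γ σ)
        → ren ρ (ren ρ′ t) ≡ ren (λ v → ρ (ρ′ v)) t
ren-ren ρ ρ′ (var x) = refl
ren-ren ρ ρ′ Kc      = refl
ren-ren ρ ρ′ Sc      = refl
ren-ren ρ ρ′ Pair    = refl
ren-ren ρ ρ′ Fst     = refl
ren-ren ρ ρ′ Snd     = refl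
ren-ren ρ ρ′ Zero    = refl
ren-ren ρ ρ′ Succ    = refl
ren-ren ρ ρ′ Rec     = refl
ren-ren ρ ρ′ (t · u) = cong₂ _·_ (ren-ren ρ ρ′ t) (ren-ren ρ ρ′ u)

sub-ren : ∀ {Γ Δ Θ σ} (θ : Sub Δ Θ) (ρ : Ren Γ Δ) (t : Tm Γ σ)
        → sub θ (ren ρ t) ≡ sub (λ v → θ (ρ v)) t
sub-ren θ ρ (var x) = refl
sub-ren θ ρ Kc      = refl
sub-ren θ ρ Sc      = refl
sub-ren θ ρ Pair    = refl
sub-ren θ ρ Fst     = refl
sub-ren θ ρ Snd     = refl
sub-ren θ ρ Zero    = refl
sub-ren θ ρ Succ    = refl
sub-ren θ ρ Rec     = refl
sub-ren θ ρ (t · u) = cong₂ _·_ (sub-ren θ ρ t) (sub-ren θ ρ u)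

ren-sub : ∀ {Γ Δ Θ σ} (ρ : Ren Δ Θ) (θ : Sub Γ Δ) (t : Tm Γ σ)
        → ren ρ (sub θ t) ≡ sub (λ v → ren ρ (θ v)) t
ren-sub ρ θ (var x) = refl
ren-sub ρ θ Kc      = refl
ren-sub ρ θ Sc      = refl
ren-sub ρ θ Pair    = refl
ren-sub ρ θ Fst     = refl
ren-sub ρ θ Snd     = refl
ren-sub ρ θ Zero    = refl
ren-sub ρ θ Succ    = refl
ren-sub ρ θ Rec     = refl
ren-sub ρ θ (t · u) = cong₂ _·_ (ren-sub ρ θ t) (ren-sub ρ θ u)

sub-id : ∀ {Γ σ} (t : Tm Γ σ) → sub var t ≡ t
sub-id (var x) = refl
sub-id Kc      = refl
sub-id Sc      = refl
sub-id Pair    = refl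
sub-id Fst     = refl
sub-id Snd     = refl
sub-id Zero    = refl
sub-id Succ    = refl
sub-id Rec     = refl
sub-id (t · u) = cong₂ _·_ (sub-id t) (sub-id u)

ren-as-sub : ∀ {Γ Δ σ} (ρ : Ren Γ Δ) (t : Tm Γ σ) → ren ρ t ≡ sub (λ v → var (ρ v)) t
ren-as-sub ρ (var x) = refl
ren-as-sub ρ Kc      = refl
ren-as-sub ρ Sc      = refl
ren-as-sub ρ Pair    = refl
ren-as-sub ρ Fst     = refl
ren-as-sub ρ Snd     = refl
ren-as-sub ρ Zero    = refl
ren-as-sub ρ Succ    = refl
ren-as-sub ρ Rec     = refl
ren-as-sub ρ (t · u) = cong₂ _·_ (ren-as-sub ρ t) (ren-as-sub ρ u)

ren-id : ∀ {Γ σ} (t : Tm Γ σ) → ren (λ v → v) t ≡ t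
ren-id t = trans (ren-as-sub (λ v → v) t) (sub-id t)

sub0-wk : ∀ {Γ σ τ} (u : Tm Γ τ) (t : Tm Γ σ) → sub (sub0 u) (wk t) ≡ t
sub0-wk u t = trans (sub-ren (sub0 u) there t) (sub-id t)

renF-ext : ∀ {Γ Δ} {ρ ρ′ : Ren Γ Δ} → ρ ≗ᵣ ρ′ → (φ : Fm Γ) → renF ρ φ ≡ renF ρ′ φ
renF-ext e ⊥ᶠ       = refl
renF-ext e (t ≐ u)  = cong₂ _≐_ (ren-ext e t) (ren-ext e u)
renF-ext e (φ ∧ᶠ ψ) = cong₂ _∧ᶠ_ (renF-ext e φ) (renF-ext e ψ)
renF-ext e (φ ∨ᶠ ψ) = cong₂ _∨ᶠ_ (renF-ext e φ) (renF-ext e ψ)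
renF-ext e (φ ⊃ ψ)  = cong₂ _⊃_ (renF-ext e φ) (renF-ext e ψ)
renF-ext e (∀ᶠ σ φ) = cong (∀ᶠ σ) (renF-ext (liftR-ext e) φ)
renF-ext e (∃ᶠ σ φ) = cong (∃ᶠ σ) (renF-ext (liftR-ext e) φ)

subF-ext : ∀ {Γ Δ} {θ θ′ : Sub Γ Δ} → θ ≗ₛ θ′ → (φ : Fm Γ) → subF θ φ ≡ subF θ′ φ
subF-ext e ⊥ᶠ       = refl
subF-ext e (t ≐ u)  = cong₂ _≐_ (sub-ext e t) (sub-ext e u)
subF-ext e (φ ∧ᶠ ψ) = cong₂ _∧ᶠ_ (subF-ext e φ) (subF-ext e ψ)
subF-ext e (φ ∨ᶠ ψ) = cong₂ _∨ᶠ_ (subF-ext e φ) (subF-ext e ψ)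
subF-ext e (φ ⊃ ψ)  = cong₂ _⊃_ (subF-ext e φ) (subF-ext e ψ)
subF-ext e (∀ᶠ σ φ) = cong (∀ᶠ σ) (subF-ext (liftS-ext e) φ)
subF-ext e (∃ᶠ σ φ) = cong (∃ᶠ σ) (subF-ext (liftS-ext e) φ)

renF-id : ∀ {Γ} (φ : Fm Γ) → renF (λ v → v) φ ≡ φ
renF-id ⊥ᶠ       = refl
renF-id (t ≐ u)  = cong₂ _≐_ (ren-id t) (ren-id u)
renF-id (φ ∧ᶠ ψ) = cong₂ _∧ᶠ_ (renF-id φ) (renF-id ψ)
renF-id (φ ∨ᶠ ψ) = cong₂ _∨ᶠ_ (renF-id φ) (renF-id ψ)
renF-id (φ ⊃ ψ)  = cong₂ _⊃_ (renF-id φ) (renF-id ψ)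
renF-id (∀ᶠ σ φ) = cong (∀ᶠ σ) (trans (renF-ext liftR-id φ) (renF-id φ))
renF-id (∃ᶠ σ φ) = cong (∃ᶠ σ) (trans (renF-ext liftR-id φ) (renF-id φ))

subF-id : ∀ {Γ} (φ : Fm Γ) → subF var φ ≡ φ
subF-id ⊥ᶠ       = refl
subF-id (t ≐ u)  = cong₂ _≐_ (sub-id t) (sub-id u)
subF-id (φ ∧ᶠ ψ) = cong₂ _∧ᶠ_ (subF-id φ) (subF-id ψ)
subF-id (φ ∨ᶠ ψ) = cong₂ _∨ᶠ_ (subF-id φ) (subF-id ψ)
subF-id (φ ⊃ ψ)  = cong₂ _⊃_ (subF-id φ) (subF-id ψ)
subF-id (∀ᶠ σ φ) = cong (∀ᶠ σ) (trans (subF-ext liftS-var φ) (subF-id φ))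
subF-id (∃ᶠ σ φ) = cong (∃ᶠ σ) (trans (subF-ext liftS-var φ) (subF-id φ))

renF-renF : ∀ {Γ Δ Θ} (ρ : Ren Δ Θ) (ρ′ : Ren Γ Δ) (φ : Fm Γ)
          → renF ρ (renF ρ′ φ) ≡ renF (λ v → ρ (ρ′ v)) φ
renF-renF ρ ρ′ ⊥ᶠ       = refl
renF-renF ρ ρ′ (t ≐ u)  = cong₂ _≐_ (ren-ren ρ ρ′ t) (ren-ren ρ ρ′ u)
renF-renF ρ ρ′ (φ ∧ᶠ ψ) = cong₂ _∧ᶠ_ (renF-renF ρ ρ′ φ) (renF-renF ρ ρ′ ψ)
renF-renF ρ ρ′ (φ ∨ᶠ ψ) = cong₂ _∨ᶠ_ (renF-renF ρ ρ′ φ) (renF-renF ρ ρ′ ψ)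
renF-renF ρ ρ′ (φ ⊃ ψ)  = cong₂ _⊃_ (renF-renF ρ ρ′ φ) (renF-renF ρ ρ′ ψ)
renF-renF ρ ρ′ (∀ᶠ σ φ) =
  cong (∀ᶠ σ) (trans (renF-renF (liftR ρ) (liftR ρ′) φ) (renF-ext (liftR-∘ ρ ρ′) φ))
renF-renF ρ ρ′ (∃ᶠ σ φ) =
  cong (∃ᶠ σ) (trans (renF-renF (liftR ρ) (liftR ρ′) φ) (renF-ext (liftR-∘ ρ ρ′) φ))

subF-renF : ∀ {Γ Δ Θ} (θ : Sub Δ Θ) (ρ : Ren Γ Δ) (φ : Fm Γ)
          → subF θ (renF ρ φ) ≡ subF (λ v → θ (ρ v)) φ
subF-renF θ ρ ⊥ᶠ       = refl
subF-renF θ ρ (t ≐ u)  = cong₂ _≐_ (sub-ren θ ρ t) (sub-ren θ ρ u)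
subF-renF θ ρ (φ ∧ᶠ ψ) = cong₂ _∧ᶠ_ (subF-renF θ ρ φ) (subF-renF θ ρ ψ)
subF-renF θ ρ (φ ∨ᶠ ψ) = cong₂ _∨ᶠ_ (subF-renF θ ρ φ) (subF-renF θ ρ ψ)
subF-renF θ ρ (φ ⊃ ψ)  = cong₂ _⊃_ (subF-renF θ ρ φ) (subF-renF θ ρ ψ)
subF-renF θ ρ (∀ᶠ σ φ) =
  cong (∀ᶠ σ) (trans (subF-renF (liftS θ) (liftR ρ) φ) (subF-ext (liftS-liftR θ ρ) φ))
subF-renF θ ρ (∃ᶠ σ φ) =
  cong (∃ᶠ σ) (trans (subF-renF (liftS θ) (liftR ρ) φ) (subF-ext (liftS-liftR θ ρ) φ))

liftR-liftS : ∀ {Γ Δ Θ τ} (ρ : Ren Δ Θ) (θ : Sub Γ Δ)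
            → (λ v → ren (liftR {τ = τ} ρ) (liftS θ v)) ≗ₛ liftS (λ v → ren ρ (θ v))
liftR-liftS ρ θ here      = refl
liftR-liftS ρ θ (there v) = trans (ren-ren (liftR ρ) there (θ v)) (sym (ren-ren there ρ (θ v)))

renF-subF : ∀ {Γ Δ Θ} (ρ : Ren Δ Θ) (θ : Sub Γ Δ) (φ : Fm Γ)
          → renF ρ (subF θ φ) ≡ subF (λ v → ren ρ (θ v)) φ
renF-subF ρ θ ⊥ᶠ       = refl
renF-subF ρ θ (t ≐ u)  = cong₂ _≐_ (ren-sub ρ θ t) (ren-sub ρ θ u)
renF-subF ρ θ (φ ∧ᶠ ψ) = cong₂ _∧ᶠ_ (renF-subF ρ θ φ) (renF-subF ρ θ ψ)
renF-subF ρ θ (φ ∨ᶠ ψ) = cong₂ _∨ᶠ_ (renF-subF ρ θ φ) (renF-subF ρ θ ψ)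
renF-subF ρ θ (φ ⊃ ψ)  = cong₂ _⊃_ (renF-subF ρ θ φ) (renF-subF ρ θ ψ)
renF-subF ρ θ (∀ᶠ σ φ) =
  cong (∀ᶠ σ) (trans (renF-subF (liftR ρ) (liftS θ) φ) (subF-ext (liftR-liftS ρ θ) φ))
renF-subF ρ θ (∃ᶠ σ φ) =
  cong (∃ᶠ σ) (trans (renF-subF (liftR ρ) (liftS θ) φ) (subF-ext (liftR-liftS ρ θ) φ))

renF-subF-square : ∀ {Γ Γ′ Δ Δ′} {ρ : Ren Γ Γ′} {θ : Sub Γ Δ} {θ′ : Sub Γ′ Δ′} {ρ′ : Ren Δ Δ′}
                 → (λ v → ren ρ′ (θ v)) ≗ₛ (λ v → θ′ (ρ v))
                 → (φ : Fm Γ) → renF ρ′ (subF θ φ) ≡ subF θ′ (renF ρ φ)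
renF-subF-square {ρ = ρ} {θ} {θ′} {ρ′} square φ =
  trans (renF-subF ρ′ θ φ) (trans (subF-ext square φ) (sym (subF-renF θ′ ρ φ)))

renF-[] : ∀ {Γ Δ σ} (ρ : Ren Γ Δ) (φ : Fm (σ ∷ Γ)) (t : Tm Γ σ)
        → renF ρ (φ [ t ]) ≡ renF (liftR ρ) φ [ ren ρ t ]
renF-[] ρ φ t = renF-subF-square square φ
  where
  square : (λ v → ren ρ (sub0 t v)) ≗ₛ (λ v → sub0 (ren ρ t) (liftR ρ v))
  square here      = refl
  square (there v) = refl

renF-subSucc : ∀ {Γ Δ} (ρ : Ren Γ Δ) (φ : Fm (𝟘 ∷ Γ))
             → renF (liftR ρ) (subF subSucc φ) ≡ subF subSucc (renF (liftR ρ) φ)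
renF-subSucc ρ φ = renF-subF-square square φ
  where
  square : (λ v → ren (liftR ρ) (subSucc v)) ≗ₛ (λ v → subSucc (liftR ρ v))
  square here      = refl
  square (there v) = refl

renF-wkF : ∀ {Γ Δ σ} (ρ : Ren Γ Δ) (φ : Fm Γ) → renF (liftR {τ = σ} ρ) (wkF φ) ≡ wkF (renF ρ φ)
renF-wkF ρ φ = trans (renF-renF (liftR ρ) there φ) (sym (renF-renF there ρ φ))

wkF-under-[#0] : ∀ {Γ σ} (φ : Fm (σ ∷ Γ)) → renF (liftR (there {τ = σ})) φ [ #0 ] ≡ φ
wkF-under-[#0] φ = trans (subF-renF (sub0 #0) (liftR there) φ) (trans (subF-ext fresh φ) (subF-id φ))
  where
  fresh : (λ v → sub0 #0 (liftR there v)) ≗ₛ var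
  fresh here      = refl
  fresh (there v) = refl

HypRen : ∀ {Γ Γ′} → Ren Γ Γ′ → List (Fm Γ) → List (Fm Γ′) → Set
HypRen ρ Δ Δ′ = ∀ {ψ} → ψ ∈ Δ → renF ρ ψ ∈ Δ′

HypRen-∷ : ∀ {Γ Γ′} {ρ : Ren Γ Γ′} {Δ Δ′ φ} → HypRen ρ Δ Δ′ → HypRen ρ (φ ∷ Δ) (renF ρ φ ∷ Δ′)
HypRen-∷ h (Any.here refl) = Any.here refl
HypRen-∷ h (Any.there p)   = Any.there (h p)

HypRen-wkF : ∀ {Γ Γ′ σ} {ρ : Ren Γ Γ′} {Δ Δ′}
           → HypRen ρ Δ Δ′ → HypRen (liftR {τ = σ} ρ) (map wkF Δ) (map wkF Δ′)
HypRen-wkF {ρ = ρ} h p with ∈-map⁻ wkF p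
... | χ , χ∈Δ , refl = subst (_∈ _) (sym (renF-wkF ρ χ)) (∈-map⁺ wkF (h χ∈Δ))

Pf-ren : ∀ {Γ Γ′ Δ Δ′ φ} (ρ : Ren Γ Γ′) → HypRen ρ Δ Δ′ → Pf Γ Δ φ → Pf Γ′ Δ′ (renF ρ φ)
Pf-ren ρ h (hyp x)            = hyp (h x)
Pf-ren ρ h (⊥E p)             = ⊥E (Pf-ren ρ h p)
Pf-ren ρ h (∧I p q)           = ∧I (Pf-ren ρ h p) (Pf-ren ρ h q)
Pf-ren ρ h (∧E₁ p)            = ∧E₁ (Pf-ren ρ h p)
Pf-ren ρ h (∧E₂ p)            = ∧E₂ (Pf-ren ρ h p)
Pf-ren ρ h (∨I₁ p)            = ∨I₁ (Pf-ren ρ h p)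
Pf-ren ρ h (∨I₂ p)            = ∨I₂ (Pf-ren ρ h p)
Pf-ren ρ h (∨E p q r)         = ∨E (Pf-ren ρ h p) (Pf-ren ρ (HypRen-∷ h) q) (Pf-ren ρ (HypRen-∷ h) r)
Pf-ren ρ h (⊃I p)             = ⊃I (Pf-ren ρ (HypRen-∷ h) p)
Pf-ren ρ h (⊃E p q)           = ⊃E (Pf-ren ρ h p) (Pf-ren ρ h q)
Pf-ren ρ h (∀I p)             = ∀I (Pf-ren (liftR ρ) (HypRen-wkF h) p)
Pf-ren ρ h (∀E {φ = φ} p t)   = subst (Pf _ _) (sym (renF-[] ρ φ t)) (∀E (Pf-ren ρ h p) (ren ρ t))
Pf-ren ρ h (∃I {φ = φ} t p)   = ∃I (ren ρ t) (subst (Pf _ _) (renF-[] ρ φ t) (Pf-ren ρ h p))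
Pf-ren ρ h (∃E {ψ = ψ} p q)   =
  ∃E (Pf-ren ρ h p) (subst (Pf _ _) (renF-wkF ρ ψ) (Pf-ren (liftR ρ) (HypRen-∷ (HypRen-wkF h)) q))
Pf-ren ρ h (eq-refl x)        = eq-refl (ren ρ x)
Pf-ren ρ h (eq-sym x y)       = eq-sym (ren ρ x) (ren ρ y)
Pf-ren ρ h (eq-trans x y z)   = eq-trans (ren ρ x) (ren ρ y) (ren ρ z)
Pf-ren ρ h (eq-cong x x′ y y′) = eq-cong (ren ρ x) (ren ρ x′) (ren ρ y) (ren ρ y′)
Pf-ren ρ h (ax-k x y)         = ax-k (ren ρ x) (ren ρ y)
Pf-ren ρ h (ax-s x y z)       = ax-s (ren ρ x) (ren ρ y) (ren ρ z)
Pf-ren ρ h (ax-fst x y)       = ax-fst (ren ρ x) (ren ρ y)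
Pf-ren ρ h (ax-snd x y)       = ax-snd (ren ρ x) (ren ρ y)
Pf-ren ρ h (ax-R0 x y)        = ax-R0 (ren ρ x) (ren ρ y)
Pf-ren ρ h (ax-RS x y m)      = ax-RS (ren ρ x) (ren ρ y) (ren ρ m)
Pf-ren ρ h (ax-Sinj x y)      = ax-Sinj (ren ρ x) (ren ρ y)
Pf-ren ρ h (ax-S≠0 x)         = ax-S≠0 (ren ρ x)
Pf-ren ρ h (ax-ind φ)         =
  subst (Pf _ _) (cong₂ (λ base step → (base ∧ᶠ ∀ᶠ 𝟘 (φ′ ⊃ step)) ⊃ ∀ᶠ 𝟘 φ′)
                        (sym (renF-[] ρ φ Zero)) (sym (renF-subSucc ρ φ)))
        (ax-ind φ′)
  where
  φ′ : Fm (𝟘 ∷ _)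
  φ′ = renF (liftR ρ) φ

Pf-wk : ∀ {Γ Δ φ τ} → Pf Γ Δ φ → Pf (τ ∷ Γ) (map wkF Δ) (wkF φ)
Pf-wk = Pf-ren there (∈-map⁺ wkF)

Pf-mono : ∀ {Γ Δ Δ′ φ} → (∀ {ψ} → ψ ∈ Δ → ψ ∈ Δ′) → Pf Γ Δ φ → Pf Γ Δ′ φ
Pf-mono {φ = φ} Δ⊆Δ′ p =
  subst (Pf _ _) (renF-id φ) (Pf-ren (λ v → v) (λ {ψ} q → subst (_∈ _) (sym (renF-id ψ)) (Δ⊆Δ′ q)) p)

weaken : ∀ {Γ Δ φ ψ} → Pf Γ Δ φ → Pf Γ (ψ ∷ Δ) φ
weaken = Pf-mono Any.there

weaken₂ : ∀ {Γ Δ φ ψ χ} → Pf Γ Δ φ → Pf Γ (ψ ∷ χ ∷ Δ) φ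
weaken₂ p = weaken (weaken p)

∀I⁻¹ : ∀ {Γ Δ σ φ} → Pf Γ Δ (∀ᶠ σ φ) → Pf (σ ∷ Γ) (map wkF Δ) φ
∀I⁻¹ {φ = φ} p = subst (Pf _ _) (wkF-under-[#0] φ) (∀E (Pf-wk p) #0)

hyp₀ : ∀ {Γ Δ φ} → Pf Γ (φ ∷ Δ) φ
hyp₀ = hyp (Any.here refl)

hyp₁ : ∀ {Γ Δ φ ψ} → Pf Γ (ψ ∷ φ ∷ Δ) φ
hyp₁ = hyp (Any.there (Any.here refl))

hyp₂ : ∀ {Γ Δ φ ψ χ} → Pf Γ (χ ∷ ψ ∷ φ ∷ Δ) φ
hyp₂ = hyp (Any.there (Any.there (Any.here refl)))

≐-refl : ∀ {Γ Δ σ} {a : Tm Γ σ} → Pf Γ Δ (a ≐ a)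
≐-refl {a = a} = eq-refl a

≐-sym : ∀ {Γ Δ σ} {a b : Tm Γ σ} → Pf Γ Δ (a ≐ b) → Pf Γ Δ (b ≐ a)
≐-sym {a = a} {b} p = ⊃E (eq-sym a b) p

infixr 5 _∙_

_∙_ : ∀ {Γ Δ σ} {a b c : Tm Γ σ} → Pf Γ Δ (a ≐ b) → Pf Γ Δ (b ≐ c) → Pf Γ Δ (a ≐ c)
_∙_ {a = a} {b} {c} p q = ⊃E (⊃E (eq-trans a b c) p) q

·-cong : ∀ {Γ Δ σ τ} {f f′ : Tm Γ (σ ⇒ τ)} {a a′ : Tm Γ σ}
       → Pf Γ Δ (f ≐ f′) → Pf Γ Δ (a ≐ a′) → Pf Γ Δ (f · a ≐ f′ · a′)
·-cong {f = f} {f′} {a} {a′} p q = ⊃E (⊃E (eq-cong f f′ a a′) p) q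

·-congˡ : ∀ {Γ Δ σ τ} {f : Tm Γ (σ ⇒ τ)} {a a′ : Tm Γ σ} → Pf Γ Δ (a ≐ a′) → Pf Γ Δ (f · a ≐ f · a′)
·-congˡ = ·-cong ≐-refl

·-congʳ : ∀ {Γ Δ σ τ} {f f′ : Tm Γ (σ ⇒ τ)} {a : Tm Γ σ} → Pf Γ Δ (f ≐ f′) → Pf Γ Δ (f · a ≐ f′ · a)
·-congʳ p = ·-cong p ≐-refl

∅ₛ : ∀ {Γ} → Sub [] Γ
∅ₛ ()

infixl 5 _,ₛ_

_,ₛ_ : ∀ {Γ Θ σ} → Sub Γ Θ → Tm Θ σ → Sub (σ ∷ Γ) Θ
(θ ,ₛ u) here      = u
(θ ,ₛ u) (there v) = θ v

infixr 4 ƛ_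

-- Kept opaque: ·-β matches on sub θ (ƛ t), and unfolding ƛ there makes checking the β-lemmas
-- below intractable.
opaque
  ƛ_ : ∀ {Γ σ τ} → Tm (σ ∷ Γ) τ → Tm Γ (σ ⇒ τ)
  ƛ_ {σ = σ} (var here) = Sc {ρ = σ} {σ = σ ⇒ σ} {τ = σ} · Kc · Kc {σ = σ}
  ƛ var (there v)       = Kc · var v
  ƛ Kc                  = Kc · Kc
  ƛ Sc                  = Kc · Sc
  ƛ Pair                = Kc · Pair
  ƛ Fst                 = Kc · Fst
  ƛ Snd                 = Kc · Snd
  ƛ Zero                = Kc · Zero
  ƛ Succ                = Kc · Succ
  ƛ Rec                 = Kc · Rec
  ƛ (t · u)             = Sc · (ƛ t) · (ƛ u)

  ƛ-β : ∀ {Γ Θ Δ σ τ} (θ : Sub Γ Θ) (t : Tm (σ ∷ Γ) τ) (u : Tm Θ σ)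
      → Pf Θ Δ (sub θ (ƛ t) · u ≐ sub (θ ,ₛ u) t)
  ƛ-β θ (var here)      u = ax-s _ _ _ ∙ ax-k _ _
  ƛ-β θ (var (there v)) u = ax-k _ _
  ƛ-β θ Kc              u = ax-k _ _
  ƛ-β θ Sc              u = ax-k _ _
  ƛ-β θ Pair            u = ax-k _ _
  ƛ-β θ Fst             u = ax-k _ _
  ƛ-β θ Snd             u = ax-k _ _
  ƛ-β θ Zero            u = ax-k _ _
  ƛ-β θ Succ            u = ax-k _ _
  ƛ-β θ Rec             u = ax-k _ _
  ƛ-β θ (t · t′)        u = ax-s _ _ _ ∙ ·-cong (ƛ-β θ t u) (ƛ-β θ t′ u)

cl-≐-sub : ∀ {Γ Δ σ} (t : Tm [] σ) → Pf Γ Δ (cl t ≐ sub ∅ₛ t)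
cl-≐-sub t = subst (λ s → Pf _ _ (cl t ≐ s)) (trans (ren-as-sub (λ ()) t) (sub-ext (λ ()) t)) ≐-refl

·-β : ∀ {Γ Θ Δ σ τ} {f : Tm Θ (σ ⇒ τ)} {θ : Sub Γ Θ} {t : Tm (σ ∷ Γ) τ}
    → Pf Θ Δ (f ≐ sub θ (ƛ t)) → (u : Tm Θ σ) → Pf Θ Δ (f · u ≐ sub (θ ,ₛ u) t)
·-β {θ = θ} {t} p u = ·-congʳ p ∙ ƛ-β θ t u

#4 : ∀ {Γ σ τ₀ τ₁ τ₂ τ₃} → Tm (τ₀ ∷ τ₁ ∷ τ₂ ∷ τ₃ ∷ σ ∷ Γ) σ
#4 = var (there (there (there (there here))))

#5 : ∀ {Γ σ τ₀ τ₁ τ₂ τ₃ τ₄} → Tm (τ₀ ∷ τ₁ ∷ τ₂ ∷ τ₃ ∷ τ₄ ∷ σ ∷ Γ) σ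
#5 = var (there (there (there (there (there here)))))

zero-or-suc : ∀ {Γ Δ} (n : Tm Γ 𝟘) → Pf Γ Δ ((n ≐ Zero) ∨ᶠ ∃ᶠ 𝟘 (wk n ≐ Succ · #0))
zero-or-suc n =
  ∀E (⊃E (ax-ind ((#0 ≐ Zero) ∨ᶠ ∃ᶠ 𝟘 (#1 ≐ Succ · #0)))
         (∧I (∨I₁ ≐-refl) (∀I (⊃I (∨I₂ (∃I #0 ≐-refl))))))
     n

≐0-dec : ∀ {Γ Δ} (n : Tm Γ 𝟘) → Pf Γ Δ ((n ≐ Zero) ∨ᶠ ¬ᶠ (n ≐ Zero))
≐0-dec n = ∨E (zero-or-suc n) (∨I₁ hyp₀) (∃E hyp₀ (∨I₂ (⊃I (⊃E (ax-S≠0 #0) (≐-sym hyp₁ ∙ hyp₀)))))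

if0 : ∀ {Γ σ} → Tm Γ 𝟘 → Tm Γ σ → Tm Γ σ → Tm Γ σ
if0 n a b = Rec · a · (Kc · (Kc · b)) · n

if0-zero : ∀ {Γ Δ σ} {n} {a b : Tm Γ σ} → Pf Γ Δ (n ≐ Zero) → Pf Γ Δ (if0 n a b ≐ a)
if0-zero n≐0 = ·-congˡ n≐0 ∙ ax-R0 _ _

if0-nonzero : ∀ {Γ Δ σ} {n} {a b : Tm Γ σ} → Pf Γ Δ (¬ᶠ (n ≐ Zero)) → Pf Γ Δ (if0 n a b ≐ b)
if0-nonzero {n = n} n≢0 =
  ∨E (zero-or-suc n) (⊥E (⊃E (weaken n≢0) hyp₀))
     (∃E hyp₀ (·-congˡ hyp₀ ∙ ax-RS _ _ _ ∙ ·-congʳ (ax-k _ _) ∙ ax-k _ _))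

-- app (σ ⊗ τ) x y z unfolds to Cases (Snd · z) (app σ …) (app τ …).
Cases : ∀ {Γ} → Tm Γ 𝟘 → Fm Γ → Fm Γ → Fm Γ
Cases n φ ψ = ((n ≐ Zero) ⊃ φ) ∧ᶠ ((¬ᶠ (n ≐ Zero)) ⊃ ψ)

Cases-zero : ∀ {Γ Δ n} {φ ψ : Fm Γ} → Pf Γ Δ (n ≐ Zero) → Pf Γ Δ (Cases n φ ψ) → Pf Γ Δ φ
Cases-zero n≐0 h = ⊃E (∧E₁ h) n≐0

Cases-nonzero : ∀ {Γ Δ n} {φ ψ : Fm Γ} → Pf Γ Δ (¬ᶠ (n ≐ Zero)) → Pf Γ Δ (Cases n φ ψ) → Pf Γ Δ ψ
Cases-nonzero n≢0 h = ⊃E (∧E₂ h) n≢0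

Cases-zero-intro : ∀ {Γ Δ n} {φ ψ : Fm Γ} → Pf Γ Δ (n ≐ Zero) → Pf Γ Δ φ → Pf Γ Δ (Cases n φ ψ)
Cases-zero-intro n≐0 p = ∧I (⊃I (weaken p)) (⊃I (⊥E (⊃E hyp₀ (weaken n≐0))))

Cases-suc-intro : ∀ {Γ Δ n m} {φ ψ : Fm Γ} → Pf Γ Δ (n ≐ Succ · m) → Pf Γ Δ ψ → Pf Γ Δ (Cases n φ ψ)
Cases-suc-intro n≐Sm p = ∧I (⊃I (⊥E (⊃E (ax-S≠0 _) (≐-sym (weaken n≐Sm) ∙ hyp₀)))) (⊃I (weaken p))

Cases-map : ∀ {Γ Δ} {n m : Tm Γ 𝟘} {φ ψ φ′ ψ′ : Fm Γ} → Pf Γ Δ (n ≐ m) → Pf Γ Δ (Cases m φ ψ)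
          → (∀ {χ} → Pf Γ (χ ∷ Δ) φ → Pf Γ (χ ∷ Δ) φ′)
          → (∀ {χ} → Pf Γ (χ ∷ Δ) ψ → Pf Γ (χ ∷ Δ) ψ′)
          → Pf Γ Δ (Cases n φ′ ψ′)
Cases-map n≐m h f g =
  ∧I (⊃I (f (Cases-zero (≐-sym (weaken n≐m) ∙ hyp₀) (weaken h))))
     (⊃I (g (Cases-nonzero (⊃I (⊃E hyp₁ (weaken₂ n≐m ∙ hyp₀))) (weaken h))))

-- eqb 0 m = if0 m 1 0 and eqb (S a) m = R 0 (λ m′ _. eqb a m′) m, with the λ compiled by hand.
isZero : ∀ {Γ} → Tm Γ (𝟘 ⇒ 𝟘)
isZero = Rec · (Succ · Zero) · (Kc · (Kc · Zero))

eqb-step : ∀ {Γ} → Tm Γ (𝟘 ⇒ (𝟘 ⇒ 𝟘) ⇒ 𝟘 ⇒ 𝟘)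
eqb-step = Kc · (Sc · (Kc · (Rec · Zero)) · (Sc · (Kc · Kc {ρ = 𝟘} {σ = 𝟘})))

eqb : ∀ {Γ} → Tm Γ (𝟘 ⇒ 𝟘 ⇒ 𝟘)
eqb = Rec · isZero · eqb-step

eqb-step-β : ∀ {Γ Δ} (a : Tm Γ 𝟘) (f : Tm Γ (𝟘 ⇒ 𝟘))
           → Pf Γ Δ (eqb-step · a · f ≐ Rec · Zero · (Sc · (Kc · Kc) · f))
eqb-step-β a f = ·-congʳ (ax-k _ _) ∙ ax-s _ _ _ ∙ ·-congʳ (ax-k _ _)

eqb-zero-zero : ∀ {Γ Δ} → Pf Γ Δ (eqb {Γ} · Zero · Zero ≐ Succ · Zero)
eqb-zero-zero = ·-congʳ (ax-R0 _ _) ∙ ax-R0 _ _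

eqb-zero-suc : ∀ {Γ Δ} (m : Tm Γ 𝟘) → Pf Γ Δ (eqb · Zero · (Succ · m) ≐ Zero)
eqb-zero-suc m = ·-congʳ (ax-R0 _ _) ∙ ax-RS _ _ _ ∙ ·-congʳ (ax-k _ _) ∙ ax-k _ _

eqb-suc-zero : ∀ {Γ Δ} (a : Tm Γ 𝟘) → Pf Γ Δ (eqb · (Succ · a) · Zero ≐ Zero)
eqb-suc-zero a = ·-congʳ (ax-RS _ _ _) ∙ ·-congʳ (eqb-step-β _ _) ∙ ax-R0 _ _

eqb-suc-suc : ∀ {Γ Δ} (a m : Tm Γ 𝟘) → Pf Γ Δ (eqb · (Succ · a) · (Succ · m) ≐ eqb · a · m)
eqb-suc-suc a m =
  ·-congʳ (ax-RS _ _ _) ∙ ·-congʳ (eqb-step-β _ _) ∙ ax-RS _ _ _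
  ∙ ·-congʳ (ax-s _ _ _ ∙ ·-congʳ (ax-k _ _)) ∙ ax-k _ _

EqbSpec : ∀ {Γ} → Tm Γ 𝟘 → Tm Γ 𝟘 → Fm Γ
EqbSpec x z = ((x ≐ z) ∧ᶠ (eqb · x · z ≐ Succ · Zero)) ∨ᶠ ((¬ᶠ (x ≐ z)) ∧ᶠ (eqb · x · z ≐ Zero))

eqb-spec-zero : ∀ {Γ Δ} → Pf Γ Δ (∀ᶠ 𝟘 (EqbSpec Zero #0))
eqb-spec-zero =
  ∀I (∨E (zero-or-suc #0)
         (∨I₁ (∧I (≐-sym hyp₀) (·-congˡ hyp₀ ∙ eqb-zero-zero)))
         (∃E hyp₀ (∨I₂ (∧I (⊃I (⊃E (ax-S≠0 #0) (≐-sym (hyp₀ ∙ hyp₁))))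
                           (·-congˡ hyp₀ ∙ eqb-zero-suc _)))))

eqb-spec-suc : ∀ {Γ Δ} → Pf Γ Δ (∀ᶠ 𝟘 (∀ᶠ 𝟘 (EqbSpec #1 #0) ⊃ ∀ᶠ 𝟘 (EqbSpec (Succ · #1) #0)))
eqb-spec-suc =
  ∀I (⊃I (∀I (∨E (zero-or-suc #0)
    (∨I₂ (∧I (⊃I (⊃E (ax-S≠0 #1) (hyp₀ ∙ hyp₁))) (·-congˡ hyp₀ ∙ eqb-suc-zero _)))
    (∃E hyp₀ (∨E (∀E hyp₂ #0)
      (∨I₁ (∧I (·-congˡ (∧E₁ hyp₀) ∙ ≐-sym hyp₁) (·-congˡ hyp₁ ∙ eqb-suc-suc _ _ ∙ ∧E₂ hyp₀)))
      (∨I₂ (∧I (⊃I (⊃E (∧E₁ hyp₁) (⊃E (ax-Sinj _ _) (hyp₀ ∙ hyp₂))))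
               (·-congˡ hyp₁ ∙ eqb-suc-suc _ _ ∙ ∧E₂ hyp₀))))))))

eqb-spec : ∀ {Γ Δ} (x z : Tm Γ 𝟘) → Pf Γ Δ (EqbSpec x z)
eqb-spec x z =
  subst (λ x′ → Pf _ _ (EqbSpec x′ z)) (sub0-wk z x)
        (∀E (∀E (⊃E (ax-ind (∀ᶠ 𝟘 (EqbSpec #1 #0))) (∧I eqb-spec-zero eqb-spec-suc)) x) z)

eqb-≐0 : ∀ {Γ Δ} {x z : Tm Γ 𝟘} → Pf Γ Δ (eqb · x · z ≐ Zero) → Pf Γ Δ (¬ᶠ (x ≐ z))
eqb-≐0 {x = x} {z} e =
  ∨E (eqb-spec x z) (⊥E (⊃E (ax-S≠0 Zero) (≐-sym (∧E₂ hyp₀) ∙ weaken e))) (∧E₁ hyp₀)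

eqb-≢0 : ∀ {Γ Δ} {x z : Tm Γ 𝟘} → Pf Γ Δ (¬ᶠ (eqb · x · z ≐ Zero)) → Pf Γ Δ (x ≐ z)
eqb-≢0 {x = x} {z} ne = ∨E (eqb-spec x z) (∧E₁ hyp₀) (⊥E (⊃E (weaken ne) (∧E₂ hyp₀)))

dom-resp : (σ : Ty) → ∀ {Γ Δ} {x x′ : Tm Γ (σ ⁺)}
         → Pf Γ Δ (x ≐ x′) → Pf Γ Δ (dom σ x) → Pf Γ Δ (dom σ x′)
app-resp : (σ : Ty) → ∀ {Γ Δ} {x x′ y y′ : Tm Γ (σ ⁺)} {z z′ : Tm Γ (σ ⁻)}
         → Pf Γ Δ (x ≐ x′) → Pf Γ Δ (y ≐ y′) → Pf Γ Δ (z ≐ z′)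
         → Pf Γ Δ (app σ x y z) → Pf Γ Δ (app σ x′ y′ z′)

dom-resp 𝟘       e h = h
dom-resp (σ ⊗ τ) e h = ∧I (dom-resp σ (·-congˡ e) (∧E₁ h)) (dom-resp τ (·-congˡ e) (∧E₂ h))
dom-resp (σ ⇒ τ) {Γ} {Δ} {x} {x′} e h =
  ∧I (∀I (⊃I (dom-resp τ (·-congʳ (·-congˡ (weaken (Pf-wk e))))
                         (⊃E (weaken (∀I⁻¹ (∧E₁ h))) hyp₀))))
     (∀I (∀I (∀I (⊃I (⊃I (⊃I
       (app-resp σ ≐-refl ≐-refl (·-congʳ (·-congʳ (·-congʳ (·-congˡ e³))))
         (⊃E (⊃E (⊃E (weaken (weaken₂ (∀I⁻¹ (∀I⁻¹ (∀I⁻¹ (∧E₂ h)))))) hyp₂) hyp₁)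
             (app-resp τ (·-congʳ (·-congˡ (≐-sym e³))) (·-congʳ (·-congˡ (≐-sym e³)))
                       ≐-refl hyp₀)))))))))
  where
  e³ : ∀ {φ ψ χ} → Pf (τ ⁻ ∷ σ ⁺ ∷ σ ⁺ ∷ Γ) (φ ∷ ψ ∷ χ ∷ map wkF (map wkF (map wkF Δ)))
                      (wk (wk (wk x)) ≐ wk (wk (wk x′)))
  e³ = weaken (weaken₂ (Pf-wk (Pf-wk (Pf-wk e))))

app-resp 𝟘 ex ey ez h = ⊃I (⊃E (weaken h) (weaken ex ∙ hyp₀ ∙ ≐-sym (weaken ey)))
app-resp (σ ⊗ τ) ex ey ez h =
  Cases-map (·-congˡ (≐-sym ez)) h
    (app-resp σ (·-congˡ (weaken ex)) (·-congˡ (weaken ey)) (·-congˡ (·-congˡ (weaken ez))))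
    (app-resp τ (·-congˡ (weaken ex)) (·-congˡ (weaken ey)) (·-congˡ (·-congˡ (weaken ez))))
app-resp (σ ⇒ τ) ex ey ez h =
  ∧I (dom-resp σ (·-congˡ ez) (∧E₁ h))
     (app-resp τ (·-cong (·-congˡ ex) (·-congˡ ez)) (·-cong (·-congˡ ey) (·-congˡ ez)) (·-congˡ ez)
                 (∧E₂ h))

app-⊗-pair : ∀ {σ τ Γ Δ} {x y : Tm Γ ((σ ⊗ τ) ⁺)} {a : Tm Γ (σ ⁻)} {b : Tm Γ (τ ⁻)} {n : Tm Γ 𝟘}
           → Pf Γ Δ (Cases n (app σ (Fst · x) (Fst · y) a) (app τ (Snd · x) (Snd · y) b))
           → Pf Γ Δ (app (σ ⊗ τ) x y (Pair · (Pair · a · b) · n))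
app-⊗-pair {σ} {τ} h =
  Cases-map (ax-snd _ _) h
    (app-resp σ ≐-refl ≐-refl (≐-sym (·-congˡ (ax-fst _ _) ∙ ax-fst _ _)))
    (app-resp τ ≐-refl ≐-refl (≐-sym (·-congˡ (ax-fst _ _) ∙ ax-snd _ _)))

app-⊗-inˡ : ∀ {σ τ Γ Δ} {x y : Tm Γ ((σ ⊗ τ) ⁺)} {a : Tm Γ (σ ⁻)} {b : Tm Γ (τ ⁻)}
          → Pf Γ Δ (app σ (Fst · x) (Fst · y) a)
          → Pf Γ Δ (app (σ ⊗ τ) x y (Pair · (Pair · a · b) · Zero))
app-⊗-inˡ p = app-⊗-pair (Cases-zero-intro ≐-refl p)

app-⊗-inʳ : ∀ {σ τ Γ Δ} {x y : Tm Γ ((σ ⊗ τ) ⁺)} {a : Tm Γ (σ ⁻)} {b : Tm Γ (τ ⁻)}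
          → Pf Γ Δ (app τ (Snd · x) (Snd · y) b)
          → Pf Γ Δ (app (σ ⊗ τ) x y (Pair · (Pair · a · b) · (Succ · Zero)))
app-⊗-inʳ p = app-⊗-pair (Cases-suc-intro ≐-refl p)

app-⇒-pair : ∀ {σ τ Γ Δ} {x y : Tm Γ ((σ ⇒ τ) ⁺)} {a : Tm Γ (σ ⁺)} {w : Tm Γ (τ ⁻)}
           → Pf Γ Δ (dom σ a) → Pf Γ Δ (app τ (x * a) (y * a) w)
           → Pf Γ Δ (app (σ ⇒ τ) x y (Pair · a · w))
app-⇒-pair {σ} {τ} d p =
  ∧I (dom-resp σ (≐-sym (ax-fst _ _)) d)
     (app-resp τ (·-congˡ (≐-sym (ax-fst _ _))) (·-congˡ (≐-sym (ax-fst _ _))) (≐-sym (ax-snd _ _)) p)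

app-irrefl : (σ : Ty) → ∀ {Γ Δ} {x : Tm Γ (σ ⁺)} {z : Tm Γ (σ ⁻)}
           → Pf Γ Δ (app σ x x z) → Pf Γ Δ ⊥ᶠ
app-irrefl 𝟘       h = ⊃E h ≐-refl
app-irrefl (σ ⊗ τ) h = app-irrefl τ (Cases-nonzero (⊃I (app-irrefl σ (Cases-zero hyp₀ (weaken h)))) h)
app-irrefl (σ ⇒ τ) h = app-irrefl τ (∧E₂ h)

-- The witnesses for the component types are arguments of the abstraction rather than part of
-- its body, so β-reduction never has to substitute into them.
sym-witness : (σ : Ty) → Tm [] (σ ⁺ ⇒ σ ⁺ ⇒ σ ⁻ ⇒ σ ⁻)
sym-witness 𝟘       = Kc · (Kc · (Kc · Zero))
sym-witness (σ ⊗ τ) =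
  (ƛ ƛ ƛ ƛ ƛ Pair · (Pair · (#4 · (Fst · #2) · (Fst · #1) · (Fst · (Fst · #0)))
                          · (#3 · (Snd · #2) · (Snd · #1) · (Snd · (Fst · #0))))
                  · (Snd · #0))
  · sym-witness σ · sym-witness τ
sym-witness (σ ⇒ τ) =
  (ƛ ƛ ƛ ƛ Pair · (Fst · #0) · (#3 · (#2 * (Fst · #0)) · (#1 * (Fst · #0)) · (Snd · #0)))
  · sym-witness τ

sym-witness-⊗-β : ∀ {σ τ Γ Δ} (x y : Tm Γ ((σ ⊗ τ) ⁺)) (z : Tm Γ ((σ ⊗ τ) ⁻))
                → Pf Γ Δ (cl (sym-witness (σ ⊗ τ)) · x · y · z
                          ≐ Pair · (Pair · (cl (sym-witness σ) · (Fst · x) · (Fst · y) · (Fst · (Fst · z)))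
                                         · (cl (sym-witness τ) · (Snd · x) · (Snd · y) · (Snd · (Fst · z))))
                                 · (Snd · z))
sym-witness-⊗-β x y z = ·-β (·-β (·-β (·-β (·-β (cl-≐-sub _) _) _) x) y) z

sym-witness-⇒-β : ∀ {σ τ Γ Δ} (x y : Tm Γ ((σ ⇒ τ) ⁺)) (z : Tm Γ ((σ ⇒ τ) ⁻))
                → Pf Γ Δ (cl (sym-witness (σ ⇒ τ)) · x · y · z
                          ≐ Pair · (Fst · z)
                                 · (cl (sym-witness τ) · (x * (Fst · z)) · (y * (Fst · z)) · (Snd · z)))
sym-witness-⇒-β x y z = ·-β (·-β (·-β (·-β (cl-≐-sub _) _) x) y) z

app-sym : (σ : Ty) → ∀ {Γ Δ} {x y : Tm Γ (σ ⁺)} {z : Tm Γ (σ ⁻)}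
        → Pf Γ Δ (app σ x y z) → Pf Γ Δ (app σ y x (cl (sym-witness σ) · x · y · z))
app-sym 𝟘 h = ⊃I (⊃E (weaken h) (≐-sym hyp₀))
app-sym (σ ⊗ τ) {x = x} {y} {z} h =
  app-resp (σ ⊗ τ) ≐-refl ≐-refl (≐-sym (sym-witness-⊗-β x y z))
    (app-⊗-pair (Cases-map ≐-refl h (app-sym σ) (app-sym τ)))
app-sym (σ ⇒ τ) {x = x} {y} {z} h =
  app-resp (σ ⇒ τ) ≐-refl ≐-refl (≐-sym (sym-witness-⇒-β x y z))
    (app-⇒-pair (∧E₁ h) (app-sym τ (∧E₂ h)))

Cotrans : (σ : Ty) → ∀ {Γ} → Tm Γ (σ ⁺) → Tm Γ (σ ⁺) → Tm Γ (σ ⁺) → Tm Γ (σ ⁻ ⊗ 𝟘) → Fm Γ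
Cotrans σ x y z p = Cases (Snd · p) (app σ x z (Fst · p)) (app σ y z (Fst · p))

Cotrans-resp : (σ : Ty) → ∀ {Γ Δ} {x y z : Tm Γ (σ ⁺)} {p p′ : Tm Γ (σ ⁻ ⊗ 𝟘)}
             → Pf Γ Δ (p ≐ p′) → Pf Γ Δ (Cotrans σ x y z p′) → Pf Γ Δ (Cotrans σ x y z p)
Cotrans-resp σ e h =
  Cases-map (·-congˡ e) h (app-resp σ ≐-refl ≐-refl (·-congˡ (≐-sym (weaken e))))
                          (app-resp σ ≐-refl ≐-refl (·-congˡ (≐-sym (weaken e))))

mapFst : ∀ {Γ α β} → (Tm Γ α → Tm Γ β) → Tm Γ (α ⊗ 𝟘) → Tm Γ (β ⊗ 𝟘)
mapFst f p = Pair · f (Fst · p) · (Snd · p)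

Cotrans-mapFst : (σ : Ty) → ∀ {Γ Δ α} {x y z : Tm Γ (σ ⁺)}
                 (f : Tm Γ α → Tm Γ (σ ⁻)) {p : Tm Γ (α ⊗ 𝟘)} {φ ψ}
               → Pf Γ Δ (Cases (Snd · p) φ ψ)
               → (∀ {χ} → Pf Γ (χ ∷ Δ) φ → Pf Γ (χ ∷ Δ) (app σ x z (f (Fst · p))))
               → (∀ {χ} → Pf Γ (χ ∷ Δ) ψ → Pf Γ (χ ∷ Δ) (app σ y z (f (Fst · p))))
               → Pf Γ Δ (Cotrans σ x y z (mapFst f p))
Cotrans-mapFst σ f h lift₁ lift₂ =
  Cases-map (ax-snd _ _) h (λ q → app-resp σ ≐-refl ≐-refl (≐-sym (ax-fst _ _)) (lift₁ q))
                           (λ q → app-resp σ ≐-refl ≐-refl (≐-sym (ax-fst _ _)) (lift₂ q))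

eqb-cotrans : ∀ {Γ Δ} {x y z : Tm Γ 𝟘}
            → Pf Γ Δ (¬ᶠ (x ≐ y)) → Pf Γ Δ (Cases (eqb · x · z) (¬ᶠ (x ≐ z)) (¬ᶠ (y ≐ z)))
eqb-cotrans x≢y = ∧I (⊃I (eqb-≐0 hyp₀)) (⊃I (⊃I (⊃E (weaken₂ x≢y) (eqb-≢0 hyp₁ ∙ ≐-sym hyp₀))))

-- The component that is not apart is copied from u, which spares an inhabitant of its type.
inˡ : ∀ {Γ σ τ} → Tm Γ ((σ ⊗ τ) ⁻) → Tm Γ (σ ⁻) → Tm Γ ((σ ⊗ τ) ⁻)
inˡ u w = Pair · (Pair · w · (Snd · (Fst · u))) · Zero

inʳ : ∀ {Γ σ τ} → Tm Γ ((σ ⊗ τ) ⁻) → Tm Γ (τ ⁻) → Tm Γ ((σ ⊗ τ) ⁻)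
inʳ u w = Pair · (Pair · (Fst · (Fst · u)) · w) · (Succ · Zero)

cotrans-witness : (σ : Ty) → Tm [] (σ ⁺ ⇒ σ ⁺ ⇒ σ ⁺ ⇒ σ ⁻ ⇒ σ ⁻ ⊗ 𝟘)
cotrans-witness 𝟘       = ƛ ƛ ƛ ƛ Pair · Zero · (eqb · #3 · #1)
cotrans-witness (σ ⊗ τ) =
  (ƛ ƛ ƛ ƛ ƛ ƛ if0 (Snd · #0)
                   (mapFst (inˡ #0) (#5 · (Fst · #3) · (Fst · #2) · (Fst · #1) · (Fst · (Fst · #0))))
                   (mapFst (inʳ #0) (#4 · (Snd · #3) · (Snd · #2) · (Snd · #1) · (Snd · (Fst · #0)))))
  · cotrans-witness σ · cotrans-witness τ
cotrans-witness (σ ⇒ τ) =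
  (ƛ ƛ ƛ ƛ ƛ mapFst (Pair · (Fst · #0) ·_)
                    (#4 · (#3 * (Fst · #0)) · (#2 * (Fst · #0)) · (#1 * (Fst · #0)) · (Snd · #0)))
  · cotrans-witness τ

cotrans-witness-𝟘-β : ∀ {Γ Δ} (x y z u : Tm Γ 𝟘)
                    → Pf Γ Δ (cl (cotrans-witness 𝟘) · x · y · z · u ≐ Pair · Zero · (eqb · x · z))
cotrans-witness-𝟘-β x y z u = ·-β (·-β (·-β (·-β (cl-≐-sub _) x) y) z) u

cotrans-witness-⊗-β : ∀ {σ τ Γ Δ} (x y z : Tm Γ ((σ ⊗ τ) ⁺)) (u : Tm Γ ((σ ⊗ τ) ⁻))
  → Pf Γ Δ (cl (cotrans-witness (σ ⊗ τ)) · x · y · z · u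
            ≐ if0 (Snd · u)
                  (mapFst (inˡ u)
                          (cl (cotrans-witness σ) · (Fst · x) · (Fst · y) · (Fst · z) · (Fst · (Fst · u))))
                  (mapFst (inʳ u)
                          (cl (cotrans-witness τ) · (Snd · x) · (Snd · y) · (Snd · z) · (Snd · (Fst · u)))))
cotrans-witness-⊗-β x y z u = ·-β (·-β (·-β (·-β (·-β (·-β (cl-≐-sub _) _) _) x) y) z) u

cotrans-witness-⇒-β : ∀ {σ τ Γ Δ} (x y z : Tm Γ ((σ ⇒ τ) ⁺)) (u : Tm Γ ((σ ⇒ τ) ⁻))
  → Pf Γ Δ (cl (cotrans-witness (σ ⇒ τ)) · x · y · z · u
            ≐ mapFst (Pair · (Fst · u) ·_)
                     (cl (cotrans-witness τ) · (x * (Fst · u)) · (y * (Fst · u)) · (z * (Fst · u))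
                                             · (Snd · u)))
cotrans-witness-⇒-β x y z u = ·-β (·-β (·-β (·-β (·-β (cl-≐-sub _) _) x) y) z) u

app-cotrans : (σ : Ty) → ∀ {Γ Δ} {x y z : Tm Γ (σ ⁺)} {u : Tm Γ (σ ⁻)}
            → Pf Γ Δ (app σ x y u) → Pf Γ Δ (Cotrans σ x y z (cl (cotrans-witness σ) · x · y · z · u))
app-cotrans 𝟘 {x = x} {y} {z} {u} h =
  Cotrans-resp 𝟘 (cotrans-witness-𝟘-β x y z u)
    (Cases-map (ax-snd _ _) (eqb-cotrans h) (λ p → p) (λ p → p))
app-cotrans (σ ⊗ τ) {x = x} {y} {z} {u} h =
  Cotrans-resp (σ ⊗ τ) (cotrans-witness-⊗-β x y z u)
    (∨E (≐0-dec (Snd · u))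
        (Cotrans-resp (σ ⊗ τ) (if0-zero hyp₀)
           (Cotrans-mapFst (σ ⊗ τ) (inˡ u) (app-cotrans σ (Cases-zero hyp₀ (weaken h)))
                           app-⊗-inˡ app-⊗-inˡ))
        (Cotrans-resp (σ ⊗ τ) (if0-nonzero hyp₀)
           (Cotrans-mapFst (σ ⊗ τ) (inʳ u) (app-cotrans τ (Cases-nonzero hyp₀ (weaken h)))
                           app-⊗-inʳ app-⊗-inʳ)))
app-cotrans (σ ⇒ τ) {x = x} {y} {z} {u} h =
  Cotrans-resp (σ ⇒ τ) (cotrans-witness-⇒-β x y z u)
    (Cotrans-mapFst (σ ⇒ τ) (Pair · (Fst · u) ·_) (app-cotrans τ (∧E₂ h))
                    (app-⇒-pair (weaken (∧E₁ h))) (app-⇒-pair (weaken (∧E₁ h))))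

lemma5p1 : (σ : Ty) →
    -- (1)  ∀x:σ⁺ ¬∃z:σ⁻ app_σ(x,x,z)
    (HA⊢ ∀ᶠ (σ ⁺) (¬ᶠ ∃ᶠ (σ ⁻) (app σ #1 #1 #0)))
    ×
    -- (2)  closed s with ∀x,y:σ⁺ ∀z:σ⁻ (app(x,y,z) → app(y,x,sxyz))
    Σ (Tm [] (σ ⁺ ⇒ σ ⁺ ⇒ σ ⁻ ⇒ σ ⁻)) (λ s →
      HA⊢ ∀ᶠ (σ ⁺) (∀ᶠ (σ ⁺) (∀ᶠ (σ ⁻)
        (app σ #2 #1 #0 ⊃ app σ #1 #2 (cl s · #2 · #1 · #0)))))
    ×
    -- (3)  closed t with ∀x,y,z:σ⁺ ∀u:σ⁻ (app(x,y,u) →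
    --        (snd p ≡ 0 → app(x,z,fst p)) ∧ (¬ snd p ≡ 0 → app(y,z,fst p))),  p := txyzu
    Σ (Tm [] (σ ⁺ ⇒ σ ⁺ ⇒ σ ⁺ ⇒ σ ⁻ ⇒ σ ⁻ ⊗ 𝟘)) (λ t →
      HA⊢ ∀ᶠ (σ ⁺) (∀ᶠ (σ ⁺) (∀ᶠ (σ ⁺) (∀ᶠ (σ ⁻)
        (app σ #3 #2 #0 ⊃
          (((Snd · (cl t · #3 · #2 · #1 · #0) ≐ Zero)
              ⊃ app σ #3 #1 (Fst · (cl t · #3 · #2 · #1 · #0)))
           ∧ᶠ ((¬ᶠ (Snd · (cl t · #3 · #2 · #1 · #0) ≐ Zero))
              ⊃ app σ #2 #1 (Fst · (cl t · #3 · #2 · #1 · #0)))))))))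
lemma5p1 σ =
  ∀I (⊃I (∃E hyp₀ (app-irrefl σ hyp₀))) ,
  (sym-witness σ , ∀I (∀I (∀I (⊃I (app-sym σ hyp₀))))) ,
  (cotrans-witness σ , ∀I (∀I (∀I (∀I (⊃I (app-cotrans σ hyp₀))))))
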